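{- Let $M$ be a primitive non-deficient number with at least four distinct prime factors. Suppose that $3\mid M$, $5^2\mid M$ and $13\mid M$. Then $3^5 \nmid M$. Furthermore, if $3^4\mid M$, then $5^3 \nmid M$ and $13^2 \nmid M$. Also, if $3^3\mid M$, then either $5^3 \nmid M$ or $13^2 \nmid M$.
   Context: $\sigma(n)$ is the sum of the positive divisors of $n$. A positive integer $n$ is deficient if $\sigma(n)<2n$. A positive integer $M$ is a primitive non-deficient number if $M$ is not deficient but every proper divisor of $M$ is deficient. -}

module Defs where

open import Data.Nat using (ℕ; suc; _+_; _*_; _<_; _≤_; _≥_)
open import Data.Nat.Divisibility using (_∣_; _∣?_)
open import Data.Nat.Primality using (Prime)
open import Data.List using (List; filter; applyUpTo)
open import Data.Nat.ListAction using (sum)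
open import Data.Product using (_×_; ∃)
open import Relation.Nullary using (¬_)
open import Relation.Binary.PropositionalEquality using (_≢_)

divisors : ℕ → List ℕ
divisors n = filter (_∣? n) (applyUpTo suc n)

σ : ℕ → ℕ
σ n = sum (divisors n)

Deficient : ℕ → Set
Deficient n = σ n < 2 * n

ProperDivisor : ℕ → ℕ → Set
ProperDivisor d M = (d ∣ M) × (1 ≤ d) × (d ≢ M)

PrimitiveNonDeficient : ℕ → Set
PrimitiveNonDeficient M =
  (M ≥ 1) × (¬ Deficient M) × (∀ d → ProperDivisor d M → Deficient d)

AtLeastFourPrimeFactors : ℕ → Set
AtLeastFourPrimeFactors M =
  ∃ λ p → ∃ λ q → ∃ λ r → ∃ λ s →
    Prime p × Prime q × Prime r × Prime s ×
    p ∣ M × q ∣ M × r ∣ M × s ∣ M ×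
    p ≢ q × p ≢ r × p ≢ s × q ≢ r × q ≢ s × r ≢ s

{-# OPTIONS --safe #-}
module Submission where

-- Each of 3⁵·5²·13, 3⁴·5³·13, 3⁴·5²·13² and 3³·5³·13² is non-deficient, which is
-- certified by exhibiting its divisors and comparing their sum with 2n.  If M satisfied
-- one of the excluded divisibilities, the corresponding number would divide M; having
-- only three prime factors it differs from M, so it would be a non-deficient proper
-- divisor of the primitive non-deficient number M.

open import Defs
open import Data.Fin using (Fin; zero; suc)
open import Data.Fin.Properties using (injective⇒≤)
open import Data.List using (List; []; _∷_; length; lookup; applyUpTo; cartesianProductWith)
open import Data.List.Membership.Propositional using (_∈_)
open import Data.List.Membership.Propositional.Properties using (∈-applyUpTo⁺; ∈-filter⁺; ∈-lookup)
open import Data.List.Relation.Binary.Subset.Propositional using (_⊆_)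
open import Data.List.Relation.Unary.All as All using (All; _∷_; all?)
open import Data.List.Relation.Unary.AllPairs using (AllPairs; []; _∷_; allPairs?)
open import Data.List.Relation.Unary.AllPairs.Properties as AllPairs using (applyUpTo⁺₁)
open import Data.List.Relation.Unary.Any using (here; there; index)
open import Data.List.Relation.Unary.Any.Properties using (lookup-index)
open import Data.List.Relation.Unary.Unique.Propositional using (Unique)
open import Data.Nat using (ℕ; zero; suc; _*_; _^_; _≤_; _<_; _<?_; _≤?_; s≤s; s<s; z≤n; NonZero; ≢-nonZero⁻¹; nonTrivial⇒≢1)
open import Data.Nat.Coprimality using (Coprime; coprime?; coprime-divisor)
open import Data.Nat.Divisibility using (_∣_; _∤_; _∣?_; divides; ∣⇒≤; 0∣⇒≡0; ∣1⇒≡1; *-monoˡ-∣)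
open import Data.Nat.ListAction using (sum)
open import Data.Nat.Primality using (Prime; prime; prime?; euclidsLemma; prime⇒irreducible)
open import Data.Nat.Properties using (≤-decTotalOrder; ≤-refl; <-cmp; <-trans; <-irrefl; <⇒≱; <⇒≢; ≤-trans; +-monoʳ-≤; m≤n+m; *-comm)
open import Data.List.Sort.InsertionSort.Base ≤-decTotalOrder using (sort)
open import Data.Product using (_×_; _,_)
open import Data.Sum using (_⊎_; inj₁; inj₂)
open import Function using (_∘_; case_of_)
open import Relation.Binary using (tri<; tri≈; tri>)
open import Relation.Binary.PropositionalEquality using (_≡_; _≢_; refl; sym; cong; subst; module ≡-Reasoning)
open import Relation.Nullary using (¬_; yes; no; contradiction)
open import Relation.Nullary.Decidable using (True; toWitness; from-yes)

⊆-drop-smaller : ∀ {y xs ys} → All (y <_) xs → xs ⊆ y ∷ ys → xs ⊆ ys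
⊆-drop-smaller y<xs xs⊆ z∈xs with xs⊆ z∈xs
... | here refl = contradiction (All.lookup y<xs z∈xs) (<-irrefl refl)
... | there z∈ys = z∈ys

sum-mono-⊆ : ∀ {xs ys} → AllPairs _<_ xs → AllPairs _<_ ys → xs ⊆ ys → sum xs ≤ sum ys
sum-mono-⊆ [] _ _ = z≤n
sum-mono-⊆ {x ∷ xs} {[]} _ _ xs⊆ with xs⊆ (here refl)
... | ()
sum-mono-⊆ {x ∷ xs} {y ∷ ys} (x<xs ∷ xs↑) (y<ys ∷ ys↑) xs⊆ with <-cmp x y
... | tri< x<y _ _ with xs⊆ (here refl)
...   | here refl = contradiction x<y (<-irrefl refl)
...   | there x∈ys = contradiction (<-trans x<y (All.lookup y<ys x∈ys)) (<-irrefl refl)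
sum-mono-⊆ {x ∷ xs} {y ∷ ys} (x<xs ∷ xs↑) (y<ys ∷ ys↑) xs⊆ | tri≈ _ refl _ =
  +-monoʳ-≤ x (sum-mono-⊆ xs↑ ys↑ (⊆-drop-smaller x<xs (xs⊆ ∘ there)))
sum-mono-⊆ {x ∷ xs} {y ∷ ys} (x<xs ∷ xs↑) (y<ys ∷ ys↑) xs⊆ | tri> _ _ y<x =
  ≤-trans (sum-mono-⊆ (x<xs ∷ xs↑) ys↑ (⊆-drop-smaller y<all xs⊆)) (m≤n+m (sum ys) y)
  where
  y<all : All (y <_) (x ∷ xs)
  y<all = y<x ∷ All.map (<-trans y<x) x<xs

∈-divisors : ∀ {n d} .{{_ : NonZero n}} → d ∣ n → d ∈ divisors n
∈-divisors {n} {zero} 0∣n = contradiction (0∣⇒≡0 0∣n) (≢-nonZero⁻¹ n)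
∈-divisors {n} {suc d} d∣n = ∈-filter⁺ (_∣? n) (∈-applyUpTo⁺ suc (∣⇒≤ d∣n)) d∣n

divisors-sorted : ∀ n → AllPairs _<_ (divisors n)
divisors-sorted n = AllPairs.filter⁺ (_∣? n) (applyUpTo⁺₁ suc n (λ i<j _ → s<s i<j))

sum≤σ : ∀ {n ds} .{{_ : NonZero n}} → AllPairs _<_ ds → All (_∣ n) ds → sum ds ≤ σ n
sum≤σ {n} ds↑ ds∣n = sum-mono-⊆ ds↑ (divisors-sorted n) (∈-divisors ∘ All.lookup ds∣n)

¬deficient-by : ∀ n ds → AllPairs _<_ ds → All (_∣ n) ds → 2 * n ≤ sum ds → ¬ Deficient n
¬deficient-by zero _ _ _ _ ()
¬deficient-by n@(suc _) ds ds↑ ds∣n 2n≤ σ<2n = <⇒≱ σ<2n (≤-trans 2n≤ (sum≤σ ds↑ ds∣n))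

¬deficient-by-sorting : ∀ n ds → let ds↑ = sort ds in
  {True (allPairs? _<?_ ds↑)} → {True (all? (_∣? n) ds↑)} → {True (2 * n ≤? sum ds↑)} →
  ¬ Deficient n
¬deficient-by-sorting n ds {ds↑} {ds∣n} {2n≤} =
  ¬deficient-by n (sort ds) (toWitness ds↑) (toWitness ds∣n) (toWitness 2n≤)

powers : ℕ → ℕ → List ℕ
powers p a = applyUpTo (p ^_) (suc a)

infixl 7 _⊗_
_⊗_ : List ℕ → List ℕ → List ℕ
_⊗_ = cartesianProductWith _*_

-- 13 ^ 1 rather than 13, so that the type is syntactically the one produced in lemma10;
-- otherwise checking their equality would unfold σ.
¬deficient[3⁵·5²·13] : ¬ Deficient (3 ^ 5 * 5 ^ 2 * 13 ^ 1)
¬deficient[3⁵·5²·13] = ¬deficient-by-sorting (3 ^ 5 * 5 ^ 2 * 13 ^ 1) (powers 3 5 ⊗ powers 5 2 ⊗ powers 13 1)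

¬deficient[3⁴·5³·13] : ¬ Deficient (3 ^ 4 * 5 ^ 3 * 13 ^ 1)
¬deficient[3⁴·5³·13] = ¬deficient-by-sorting (3 ^ 4 * 5 ^ 3 * 13 ^ 1) (powers 3 4 ⊗ powers 5 3 ⊗ powers 13 1)

¬deficient[3⁴·5²·13²] : ¬ Deficient (3 ^ 4 * 5 ^ 2 * 13 ^ 2)
¬deficient[3⁴·5²·13²] = ¬deficient-by-sorting (3 ^ 4 * 5 ^ 2 * 13 ^ 2) (powers 3 4 ⊗ powers 5 2 ⊗ powers 13 2)

¬deficient[3³·5³·13²] : ¬ Deficient (3 ^ 3 * 5 ^ 3 * 13 ^ 2)
¬deficient[3³·5³·13²] = ¬deficient-by-sorting (3 ^ 3 * 5 ^ 3 * 13 ^ 2) (powers 3 3 ⊗ powers 5 3 ⊗ powers 13 2)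

lookup-injective : ∀ {xs : List ℕ} → Unique xs → ∀ {i j} → lookup xs i ≡ lookup xs j → i ≡ j
lookup-injective (_ ∷ _) {zero} {zero} _ = refl
lookup-injective (x≢xs ∷ _) {zero} {suc j} eq = contradiction eq (All.lookup x≢xs (∈-lookup j))
lookup-injective (x≢xs ∷ _) {suc i} {zero} eq = contradiction (sym eq) (All.lookup x≢xs (∈-lookup i))
lookup-injective (_ ∷ xs!) {suc i} {suc j} eq = cong suc (lookup-injective xs! eq)

unique-⊆⇒length≤ : ∀ {xs ys} → Unique xs → xs ⊆ ys → length xs ≤ length ys
unique-⊆⇒length≤ {xs} {ys} xs! xs⊆ys = injective⇒≤ position-injective
  where
  position : Fin (length xs) → Fin (length ys)
  position i = index (xs⊆ys (∈-lookup i))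

  position-injective : ∀ {i j} → position i ≡ position j → i ≡ j
  position-injective {i} {j} eq = lookup-injective xs! (begin
    lookup xs i              ≡⟨ lookup-index (xs⊆ys (∈-lookup i)) ⟩
    lookup ys (position i)   ≡⟨ cong (lookup ys) eq ⟩
    lookup ys (position j)   ≡⟨ lookup-index (xs⊆ys (∈-lookup j)) ⟨
    lookup xs j              ∎)
    where open ≡-Reasoning

four≤length-of-prime-cover : ∀ {M ps} → AtLeastFourPrimeFactors M →
  (∀ {p} → Prime p → p ∣ M → p ∈ ps) → 4 ≤ length ps
four≤length-of-prime-cover {ps = ps}
  (p , q , r , s , p′ , q′ , r′ , s′ , p∣ , q∣ , r∣ , s∣ , p≢q , p≢r , p≢s , q≢r , q≢s , r≢s) cover =
  unique-⊆⇒length≤ ((p≢q ∷ p≢r ∷ p≢s ∷ All.[]) ∷ (q≢r ∷ q≢s ∷ All.[]) ∷ (r≢s ∷ All.[]) ∷ All.[] ∷ []) ⊆ps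
  where
  ⊆ps : p ∷ q ∷ r ∷ s ∷ [] ⊆ ps
  ⊆ps (here refl) = cover p′ p∣
  ⊆ps (there (here refl)) = cover q′ q∣
  ⊆ps (there (there (here refl))) = cover r′ r∣
  ⊆ps (there (there (there (here refl)))) = cover s′ s∣

prime≢1 : ∀ {p} → Prime p → p ≢ 1
prime≢1 (prime {{p>1}} _) = nonTrivial⇒≢1 {{p>1}}

prime∣^⇒≡ : ∀ {p q} n → Prime p → Prime q → p ∣ q ^ n → p ≡ q
prime∣^⇒≡ zero p′ _ p∣1 = contradiction (∣1⇒≡1 p∣1) (prime≢1 p′)
prime∣^⇒≡ {q = q} (suc n) p′ q′ p∣qⁿ⁺¹ with euclidsLemma q (q ^ n) p′ p∣qⁿ⁺¹
... | inj₂ p∣qⁿ = prime∣^⇒≡ n p′ q′ p∣qⁿ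
... | inj₁ p∣q with prime⇒irreducible q′ p∣q
...   | inj₁ p≡1 = contradiction p≡1 (prime≢1 p′)
...   | inj₂ p≡q = p≡q

prime∣^*^*^⇒∈ : ∀ {p q r s} a b c → Prime p → Prime q → Prime r → Prime s →
  p ∣ q ^ a * r ^ b * s ^ c → p ∈ q ∷ r ∷ s ∷ []
prime∣^*^*^⇒∈ a b c p′ q′ r′ s′ p∣ with euclidsLemma _ _ p′ p∣
... | inj₂ p∣sᶜ = there (there (here (prime∣^⇒≡ c p′ s′ p∣sᶜ)))
... | inj₁ p∣qᵃrᵇ with euclidsLemma _ _ p′ p∣qᵃrᵇ
...   | inj₁ p∣qᵃ = here (prime∣^⇒≡ a p′ q′ p∣qᵃ)
...   | inj₂ p∣rᵇ = there (here (prime∣^⇒≡ b p′ r′ p∣rᵇ))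

positive-divisor : ∀ {d M} → 1 ≤ M → d ∣ M → 1 ≤ d
positive-divisor {zero} 1≤M 0∣M = contradiction (sym (0∣⇒≡0 0∣M)) (<⇒≢ 1≤M)
positive-divisor {suc _} _ _ = s≤s z≤n

deficient-if-≤3-prime-factors : ∀ {M d} (ps : List ℕ) → PrimitiveNonDeficient M →
  AtLeastFourPrimeFactors M → length ps < 4 → (∀ {p} → Prime p → p ∣ d → p ∈ ps) →
  d ∣ M → Deficient d
deficient-if-≤3-prime-factors ps (1≤M , _ , proper⇒deficient) four |ps|<4 cover d∣M =
  proper⇒deficient _ (d∣M , positive-divisor 1≤M d∣M , d≢M)
  where
  d≢M : _ ≢ _
  d≢M refl = <⇒≱ |ps|<4 (four≤length-of-prime-cover four cover)

∣-coprime-* : ∀ {m n k} → Coprime m n → m ∣ k → n ∣ k → m * n ∣ k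
∣-coprime-* {m} {n} m⊥n m∣k (divides q refl) =
  *-monoˡ-∣ n (coprime-divisor m⊥n (subst (m ∣_) (*-comm q n) m∣k))

lemma10 : (M : ℕ) → PrimitiveNonDeficient M → AtLeastFourPrimeFactors M →
    3 ∣ M → 5 ^ 2 ∣ M → 13 ∣ M →
    (3 ^ 5 ∤ M) ×
    (3 ^ 4 ∣ M → (5 ^ 3 ∤ M) × (13 ^ 2 ∤ M)) ×
    (3 ^ 3 ∣ M → (5 ^ 3 ∤ M) ⊎ (13 ^ 2 ∤ M))
lemma10 M pnd four _ 5²∣M 13∣M =
    (λ 3⁵∣M → ¬deficient[3⁵·5²·13] (deficient 5 2 1 3⁵∣M 5²∣M 13∣M))
  , (λ 3⁴∣M → (λ 5³∣M → ¬deficient[3⁴·5³·13] (deficient 4 3 1 3⁴∣M 5³∣M 13∣M))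
            , (λ 13²∣M → ¬deficient[3⁴·5²·13²] (deficient 4 2 2 3⁴∣M 5²∣M 13²∣M)))
  , (λ 3³∣M → case 5 ^ 3 ∣? M of λ where
      (yes 5³∣M) → inj₂ (λ 13²∣M → ¬deficient[3³·5³·13²] (deficient 3 3 2 3³∣M 5³∣M 13²∣M))
      (no 5³∤M) → inj₁ 5³∤M)
  where
  deficient : ∀ a b c → {True (coprime? (3 ^ a) (5 ^ b))} →
    {True (coprime? (3 ^ a * 5 ^ b) (13 ^ c))} →
    3 ^ a ∣ M → 5 ^ b ∣ M → 13 ^ c ∣ M → Deficient (3 ^ a * 5 ^ b * 13 ^ c)
  deficient a b c {3ᵃ⊥5ᵇ} {3ᵃ5ᵇ⊥13ᶜ} 3ᵃ∣M 5ᵇ∣M 13ᶜ∣M =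
    deficient-if-≤3-prime-factors (3 ∷ 5 ∷ 13 ∷ []) pnd four ≤-refl
      (λ p′ → prime∣^*^*^⇒∈ a b c p′ (from-yes (prime? 3)) (from-yes (prime? 5)) (from-yes (prime? 13)))
      (∣-coprime-* (toWitness 3ᵃ5ᵇ⊥13ᶜ) (∣-coprime-* (toWitness 3ᵃ⊥5ᵇ) 3ᵃ∣M 5ᵇ∣M) 13ᶜ∣M)
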